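{- Let $G$ be a graph, let $S$ be a $t$-secluded induced star in $G$ and let $x$ be the center of $S$. Then $N_G(V(S))$ is a vertex cover of $F_x$. Moreover, if $S$ is an inclusion-maximal $t$-secluded induced star with center $x$, then $N_G(V(S))$ is an inclusion-minimal vertex cover of $F_x$.
   Context: All graphs are finite, simple, undirected. For $U\subseteq V(G)$, $N_G(U)=\left(\bigcup_{v\in U}N_G(v)\right)\setminus U$; an induced subgraph $S$ is $t$-secluded if $|N_G(V(S))|\le t$. The center of a star is its vertex of maximum degree. For $x\in V(G)$, $N^2(x)$ is the set of vertices at distance exactly $2$ from $x$, and $F_x$ is the graph with vertex set $N(x)\cup N^2(x)$ (so $x\notin V(F_x)$) whose edge set consists of the edges of $G[N(x)\cup N^2(x)]$ except those with both endpoints in $N^2(x)$. -}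

module Defs where

open import Data.Nat using (ℕ; zero; suc; _≤_)
open import Data.Bool using (Bool; true; false; _∧_; _∨_; not)
open import Data.Fin using (Fin; zero; suc)
import Data.Fin as Fin
open import Data.Fin.Subset using (Subset; _∈_; _⊆_; ∣_∣; _∪_)
open import Data.Vec using (tabulate; lookup)
open import Data.Product using (_×_; Σ)
open import Data.Sum using (_⊎_)
open import Relation.Nullary using (¬_; does)
open import Relation.Binary.PropositionalEquality using (_≡_; _≢_)

record Graph : Set where
  field
    n     : ℕ
    adj   : Fin n → Fin n → Bool
    sym   : ∀ u v → adj u v ≡ adj v u
    irref : ∀ v → adj v v ≡ false
open Graph public

anyᵇ : ∀ {m} → (Fin m → Bool) → Bool
anyᵇ {zero}  f = false
anyᵇ {suc m} f = f zero ∨ anyᵇ (λ i → f (suc i))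

module _ (G : Graph) where
  private
    V = Fin (n G)
    A = adj G

  N : Subset (n G) → Subset (n G)
  N U = tabulate λ v → not (lookup U v) ∧ anyᵇ (λ u → lookup U u ∧ A u v)

  N1 : V → Subset (n G)
  N1 x = tabulate λ v → A x v

  N2 : V → Subset (n G)
  N2 x = tabulate λ v → not (does (v Fin.≟ x)) ∧ not (A x v)
                         ∧ anyᵇ (λ u → A x u ∧ A u v)

  VF : V → Subset (n G)
  VF x = N1 x ∪ N2 x

  -- edges of F_x: edges of G[N(x) ∪ N²(x)] not having both ends in N²(x)
  FEdge : V → V → V → Set
  FEdge x u v = (A u v ≡ true) × (u ∈ VF x) × (v ∈ VF x)
                × ¬ ((u ∈ N2 x) × (v ∈ N2 x))

  IsVertexCoverF : V → Subset (n G) → Set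
  IsVertexCoverF x C = (C ⊆ VF x) × (∀ u v → FEdge x u v → (u ∈ C) ⊎ (v ∈ C))

  IsMinimalVertexCoverF : V → Subset (n G) → Set
  IsMinimalVertexCoverF x C =
    IsVertexCoverF x C × (∀ C' → IsVertexCoverF x C' → C' ⊆ C → C ⊆ C')

  IsInducedStar : Subset (n G) → V → Set
  IsInducedStar U x =
    (x ∈ U)
    × (∀ v → v ∈ U → v ≢ x → A x v ≡ true)
    × (∀ u v → u ∈ U → v ∈ U → u ≢ x → v ≢ x → A u v ≡ false)

  Secluded : ℕ → Subset (n G) → Set
  Secluded t U = ∣ N U ∣ ≤ t

  IsMaximalSecludedStar : ℕ → Subset (n G) → V → Set
  IsMaximalSecludedStar t U x =
    IsInducedStar U x × Secluded t U
    × (∀ U' → IsInducedStar U' x → Secluded t U' → U ⊆ U' → U' ⊆ U)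

-- Every edge of F_x has an end u in N(x). If u ∉ S then u ∈ N(S) because x ∈ S;
-- if u ∈ S then u is a leaf, and the other end, being distinct from x, cannot be a
-- leaf as well, so it lies in N(S). For minimality let S be maximal, C ⊆ N(S) a
-- cover of F_x and v ∈ N(S) \ C. Since C ∩ S = ∅, no leaf of S is adjacent to v.
-- If v ∈ N²(x) this contradicts v ∈ N(S); if v ∈ N(x) then S + v is an induced
-- star whose new neighbours all lie in C ⊆ N(S), so it is t-secluded, and
-- maximality puts v into S, again contradicting v ∈ N(S).
module Submission where

open import Defs renaming (sym to adj-sym)
open import Data.Bool using (Bool; true; false; _∧_; not)
open import Data.Empty using (⊥; ⊥-elim)
open import Data.Fin using (Fin; zero; suc; _≟_)
open import Data.Fin.Subset using (Subset; _∈_; _∉_; _⊆_; _∪_; ⁅_⁆)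
open import Data.Fin.Subset.Properties
  using (_∈?_; x∈p∪q⁺; x∈p∪q⁻; p⊆p∪q; q⊆p∪q; x∈⁅x⁆; x∈⁅y⁆⇒x≡y; p⊆q⇒∣p∣≤∣q∣)
open import Data.Nat using (ℕ)
import Data.Nat as ℕ
open import Data.Nat.Properties using (≤-trans)
open import Data.Product using (_×_; _,_; ∃; proj₁; proj₂)
import Data.Product as Product
open import Data.Sum using (_⊎_; inj₁; inj₂; [_,_]; swap)
import Data.Sum as Sum
open import Data.Vec using (lookup; tabulate)
open import Data.Vec.Properties using (lookup∘tabulate; []=⇒lookup; lookup⇒[]=)
open import Function using (_∘_; id)
open import Relation.Binary.PropositionalEquality
  using (_≡_; _≢_; refl; sym; trans; cong)
open import Relation.Nullary using (¬_; Dec; does; yes; no)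
open import Relation.Nullary.Decidable using (dec-true; dec-false)

true≢false : true ≢ false
true≢false ()

∧-true⁻ : ∀ {a b} → a ∧ b ≡ true → a ≡ true × b ≡ true
∧-true⁻ {true} b≡true = refl , b≡true

∧-true⁺ : ∀ {a b} → a ≡ true → b ≡ true → a ∧ b ≡ true
∧-true⁺ refl refl = refl

not-true⁻ : ∀ {a} → not a ≡ true → a ≡ false
not-true⁻ {false} refl = refl

does≡false⇒¬ : ∀ {a} {A : Set a} (a? : Dec A) → does a? ≡ false → ¬ A
does≡false⇒¬ a? eq a = true≢false (trans (sym (dec-true a? a)) eq)

anyᵇ-witness : ∀ {m} (f : Fin m → Bool) → anyᵇ f ≡ true → ∃ λ i → f i ≡ true
anyᵇ-witness {ℕ.zero}  f ()
anyᵇ-witness {ℕ.suc m} f any≡true with f zero in f0≡true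
... | true  = zero , f0≡true
... | false = Product.map suc id (anyᵇ-witness (f ∘ suc) any≡true)

anyᵇ-intro : ∀ {m} (f : Fin m → Bool) i → f i ≡ true → anyᵇ f ≡ true
anyᵇ-intro f zero    fi≡true rewrite fi≡true = refl
anyᵇ-intro f (suc i) fi≡true with f zero
... | true  = refl
... | false = anyᵇ-intro (f ∘ suc) i fi≡true

module _ {m : ℕ} where

  ∈-tabulate⁻ : ∀ {f : Fin m → Bool} {v} → v ∈ tabulate f → f v ≡ true
  ∈-tabulate⁻ {f} {v} v∈ = trans (sym (lookup∘tabulate f v)) ([]=⇒lookup v∈)

  ∈-tabulate⁺ : ∀ {f : Fin m → Bool} {v} → f v ≡ true → v ∈ tabulate f
  ∈-tabulate⁺ {f} {v} fv≡true = lookup⇒[]= v _ (trans (lookup∘tabulate f v) fv≡true)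

  lookup≡false⇒∉ : ∀ {p : Subset m} {v} → lookup p v ≡ false → v ∉ p
  lookup≡false⇒∉ eq v∈p = true≢false (trans (sym ([]=⇒lookup v∈p)) eq)

  ∉⇒lookup≡false : ∀ {p : Subset m} {v} → v ∉ p → lookup p v ≡ false
  ∉⇒lookup≡false {p} {v} v∉p with lookup p v in eq
  ... | true  = ⊥-elim (v∉p (lookup⇒[]= v p eq))
  ... | false = refl

  ∈-∪⁅⁆⁻ : ∀ {p : Subset m} {v w} → w ∈ p ∪ ⁅ v ⁆ → w ∈ p ⊎ w ≡ v
  ∈-∪⁅⁆⁻ {p} {v} w∈ = Sum.map id (x∈⁅y⁆⇒x≡y v) (x∈p∪q⁻ p ⁅ v ⁆ w∈)

module _ (G : Graph) where
  private
    V : Set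
    V = Fin (n G)

    A : V → V → Bool
    A = adj G

  adj⇒≢ : ∀ {u v : V} → A u v ≡ true → v ≢ u
  adj⇒≢ {u} a refl = true≢false (trans (sym a) (irref G u))

  ∈-N⁻ : ∀ {U v} → v ∈ N G U → v ∉ U × ∃ λ u → u ∈ U × A u v ≡ true
  ∈-N⁻ {U} v∈ with ∧-true⁻ (∈-tabulate⁻ v∈)
  ... | v∉U , any≡true with anyᵇ-witness _ any≡true
  ...   | u , u∈U∧a = lookup≡false⇒∉ (not-true⁻ v∉U)
                    , u , lookup⇒[]= u U (proj₁ (∧-true⁻ u∈U∧a)) , proj₂ (∧-true⁻ u∈U∧a)

  ∈-N⁺ : ∀ {U u v} → v ∉ U → u ∈ U → A u v ≡ true → v ∈ N G U
  ∈-N⁺ {u = u} v∉U u∈U a = ∈-tabulate⁺ (∧-true⁺ (cong not (∉⇒lookup≡false v∉U))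
                                       (anyᵇ-intro _ u (∧-true⁺ ([]=⇒lookup u∈U) a)))

  ∈-N1⁻ : ∀ {x v} → v ∈ N1 G x → A x v ≡ true
  ∈-N1⁻ = ∈-tabulate⁻

  ∈-N1⁺ : ∀ {x v} → A x v ≡ true → v ∈ N1 G x
  ∈-N1⁺ = ∈-tabulate⁺

  ∈-N2⁻ : ∀ {x v} → v ∈ N2 G x → v ≢ x × A x v ≡ false
  ∈-N2⁻ {x} {v} v∈ with ∧-true⁻ (∈-tabulate⁻ v∈)
  ... | v≠x , rest = does≡false⇒¬ (v ≟ x) (not-true⁻ v≠x) , not-true⁻ (proj₁ (∧-true⁻ rest))

  ∈-N2⁺ : ∀ {x u v} → v ≢ x → A x v ≡ false → A x u ≡ true → A u v ≡ true → v ∈ N2 G x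
  ∈-N2⁺ {x} {u} {v} v≢x ¬axv axu auv =
    ∈-tabulate⁺ (∧-true⁺ (cong not (dec-false (v ≟ x) v≢x))
                (∧-true⁺ (cong not ¬axv) (anyᵇ-intro _ u (∧-true⁺ axu auv))))

  adj⇒∉N2 : ∀ {x w} → A x w ≡ true → w ∉ N2 G x
  adj⇒∉N2 axw w∈N2 = true≢false (trans (sym axw) (proj₂ (∈-N2⁻ w∈N2)))

  ∈-VF⁻ : ∀ {x v} → v ∈ VF G x → A x v ≡ true ⊎ v ∈ N2 G x
  ∈-VF⁻ {x} v∈ = Sum.map ∈-N1⁻ id (x∈p∪q⁻ (N1 G x) (N2 G x) v∈)

  ∈-VF⇒≢ : ∀ {x v} → v ∈ VF G x → v ≢ x
  ∈-VF⇒≢ v∈ with ∈-VF⁻ v∈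
  ... | inj₁ axv   = adj⇒≢ axv
  ... | inj₂ v∈N2 = proj₁ (∈-N2⁻ v∈N2)

  ∈-VF-N1⁺ : ∀ {x v} → A x v ≡ true → v ∈ VF G x
  ∈-VF-N1⁺ axv = x∈p∪q⁺ (inj₁ (∈-N1⁺ axv))

  ∈-VF-path⁺ : ∀ {x u v} → v ≢ x → A x u ≡ true → A u v ≡ true → v ∈ VF G x
  ∈-VF-path⁺ {x} {v = v} v≢x axu auv with A x v in axv
  ... | true  = ∈-VF-N1⁺ axv
  ... | false = x∈p∪q⁺ (inj₂ (∈-N2⁺ v≢x axv axu auv))

  FEdge-sym : ∀ {x u v} → FEdge G x u v → FEdge G x v u
  FEdge-sym {u = u} {v} (auv , u∈ , v∈ , ¬both) =
    trans (adj-sym G v u) auv , v∈ , u∈ , ¬both ∘ Product.swap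

  FEdge-from-N1 : ∀ {x u v} → A x u ≡ true → A u v ≡ true → v ∈ VF G x → FEdge G x u v
  FEdge-from-N1 axu auv v∈ = auv , ∈-VF-N1⁺ axu , v∈ , adj⇒∉N2 axu ∘ proj₁

  FEdge⇒endpoint-in-N1 : ∀ {x u v} → FEdge G x u v → A x u ≡ true ⊎ A x v ≡ true
  FEdge⇒endpoint-in-N1 (_ , u∈ , v∈ , ¬both) with ∈-VF⁻ u∈ | ∈-VF⁻ v∈
  ... | inj₁ axu   | _           = inj₁ axu
  ... | inj₂ _     | inj₁ axv    = inj₂ axv
  ... | inj₂ u∈N2 | inj₂ v∈N2 = ⊥-elim (¬both (u∈N2 , v∈N2))

  star-extend : ∀ {S x v} → IsInducedStar G S x → A x v ≡ true →
                (∀ u → u ∈ S → u ≢ x → A u v ≡ false) → IsInducedStar G (S ∪ ⁅ v ⁆) x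
  star-extend {S} {x} {v} (x∈S , centre , indep) axv leaves↛v =
    p⊆p∪q ⁅ v ⁆ x∈S , centre′ , indep′
    where
    centre′ : ∀ w → w ∈ S ∪ ⁅ v ⁆ → w ≢ x → A x w ≡ true
    centre′ w w∈ w≢x with ∈-∪⁅⁆⁻ w∈
    ... | inj₁ w∈S = centre w w∈S w≢x
    ... | inj₂ refl = axv
    indep′ : ∀ u w → u ∈ S ∪ ⁅ v ⁆ → w ∈ S ∪ ⁅ v ⁆ → u ≢ x → w ≢ x → A u w ≡ false
    indep′ u w u∈ w∈ u≢x w≢x with ∈-∪⁅⁆⁻ u∈ | ∈-∪⁅⁆⁻ w∈
    ... | inj₁ u∈S | inj₁ w∈S = indep u w u∈S w∈S u≢x w≢x
    ... | inj₁ u∈S | inj₂ refl = leaves↛v u u∈S u≢x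
    ... | inj₂ refl | inj₁ w∈S = trans (adj-sym G v w) (leaves↛v w w∈S w≢x)
    ... | inj₂ refl | inj₂ refl = irref G v

  ∈-N-∪⁅⁆⁻ : ∀ {U v w} → w ∈ N G (U ∪ ⁅ v ⁆) →
             w ∈ N G U ⊎ (w ∉ U ∪ ⁅ v ⁆ × A v w ≡ true)
  ∈-N-∪⁅⁆⁻ {U} {v} w∈ with ∈-N⁻ w∈
  ... | w∉ , u , u∈ , auw with ∈-∪⁅⁆⁻ {p = U} {v} u∈
  ...   | inj₁ u∈U = inj₁ (∈-N⁺ (w∉ ∘ p⊆p∪q _) u∈U auw)
  ...   | inj₂ refl = inj₂ (w∉ , auw)

  module InducedStar {S : Subset (n G)} {x : V} (star : IsInducedStar G S x) where
    private
      x∈S : x ∈ S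
      x∈S = proj₁ star

      centre : ∀ v → v ∈ S → v ≢ x → A x v ≡ true
      centre = proj₁ (proj₂ star)

      indep : ∀ u v → u ∈ S → v ∈ S → u ≢ x → v ≢ x → A u v ≡ false
      indep = proj₂ (proj₂ star)

    ∉S⇒≢centre : ∀ {v} → v ∉ S → v ≢ x
    ∉S⇒≢centre v∉S refl = v∉S x∈S

    N⊆VF : N G S ⊆ VF G x
    N⊆VF v∈ with ∈-N⁻ v∈
    ... | v∉S , u , u∈S , auv with u ≟ x
    ...   | yes refl = ∈-VF-N1⁺ auv
    ...   | no u≢x   = ∈-VF-path⁺ (∉S⇒≢centre v∉S) (centre u u∈S u≢x) auv

    edge-at-N1-hits-N : ∀ {u v} → A x u ≡ true → A u v ≡ true → v ≢ x →
                        u ∈ N G S ⊎ v ∈ N G S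
    edge-at-N1-hits-N {u} {v} axu auv v≢x with u ∈? S | v ∈? S
    ... | no u∉S  | _       = inj₁ (∈-N⁺ u∉S x∈S axu)
    ... | yes u∈S | no v∉S  = inj₂ (∈-N⁺ v∉S u∈S auv)
    ... | yes u∈S | yes v∈S =
      ⊥-elim (true≢false (trans (sym auv) (indep u v u∈S v∈S (adj⇒≢ axu) v≢x)))

    N-cover : IsVertexCoverF G x (N G S)
    N-cover = N⊆VF , covers
      where
      covers : ∀ u v → FEdge G x u v → u ∈ N G S ⊎ v ∈ N G S
      covers u v e@(auv , _ , v∈ , _) with FEdge⇒endpoint-in-N1 e
      ... | inj₁ axu = edge-at-N1-hits-N axu auv (∈-VF⇒≢ v∈)
      ... | inj₂ axv with FEdge-sym e
      ...   | (avu , _ , u∈ , _) = swap (edge-at-N1-hits-N axv avu (∈-VF⇒≢ u∈))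

    module _ {t : ℕ} (maximal : IsMaximalSecludedStar G t S x)
             {C : Subset (n G)} (C-cover : IsVertexCoverF G x C) (C⊆N : C ⊆ N G S)
             {v : V} (v∈N : v ∈ N G S) (v∉C : v ∉ C) where
      private
        v∉S : v ∉ S
        v∉S = proj₁ (∈-N⁻ {S} v∈N)

        v∈VF : v ∈ VF G x
        v∈VF = N⊆VF v∈N

      ∈S⇒∉C : ∀ {w} → w ∈ S → w ∉ C
      ∈S⇒∉C w∈S w∈C = proj₁ (∈-N⁻ {S} (C⊆N w∈C)) w∈S

      leaves↛v : ∀ u → u ∈ S → u ≢ x → A u v ≡ false
      leaves↛v u u∈S u≢x with A u v in auv
      ... | false = refl
      ... | true with proj₂ C-cover u v (FEdge-from-N1 (centre u u∈S u≢x) auv v∈VF)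
      ...   | inj₁ u∈C = ⊥-elim (∈S⇒∉C u∈S u∈C)
      ...   | inj₂ v∈C = ⊥-elim (v∉C v∈C)

      v∉N2 : v ∉ N2 G x
      v∉N2 v∈N2 with ∈-N⁻ v∈N
      ... | _ , u , u∈S , auv with u ≟ x
      ...   | yes refl = true≢false (trans (sym auv) (proj₂ (∈-N2⁻ v∈N2)))
      ...   | no u≢x   = true≢false (trans (sym auv) (leaves↛v u u∈S u≢x))

      N-extend⊆N : A x v ≡ true → N G (S ∪ ⁅ v ⁆) ⊆ N G S
      N-extend⊆N axv w∈ with ∈-N-∪⁅⁆⁻ w∈
      ... | inj₁ w∈N = w∈N
      ... | inj₂ (w∉ , avw) with proj₂ C-cover _ _ (FEdge-from-N1 axv avw
                                   (∈-VF-path⁺ (∉S⇒≢centre (w∉ ∘ p⊆p∪q _)) axv avw))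
      ...   | inj₁ v∈C = ⊥-elim (v∉C v∈C)
      ...   | inj₂ w∈C = C⊆N w∈C

      v∉N1 : v ∉ N1 G x
      v∉N1 v∈N1 = v∉S (grows (p⊆p∪q ⁅ v ⁆) (q⊆p∪q S ⁅ v ⁆ (x∈⁅x⁆ v)))
        where
        axv : A x v ≡ true
        axv = ∈-N1⁻ v∈N1
        secluded : Secluded G t S
        secluded = proj₁ (proj₂ maximal)
        grows : S ⊆ S ∪ ⁅ v ⁆ → S ∪ ⁅ v ⁆ ⊆ S
        grows = proj₂ (proj₂ maximal) (S ∪ ⁅ v ⁆)
                  (star-extend star axv leaves↛v)
                  (≤-trans (p⊆q⇒∣p∣≤∣q∣ (N-extend⊆N axv)) secluded)

      uncovered-absurd : ⊥
      uncovered-absurd = [ v∉N1 , v∉N2 ] (x∈p∪q⁻ (N1 G x) (N2 G x) v∈VF)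

    N-minimal-cover : ∀ {t} → IsMaximalSecludedStar G t S x → IsMinimalVertexCoverF G x (N G S)
    N-minimal-cover maximal = N-cover , minimal
      where
      minimal : ∀ C → IsVertexCoverF G x C → C ⊆ N G S → N G S ⊆ C
      minimal C C-cover C⊆N {v} v∈N with v ∈? C
      ... | yes v∈C = v∈C
      ... | no v∉C  = ⊥-elim (uncovered-absurd maximal C-cover C⊆N v∈N v∉C)

mainTheorem14 : (G : Graph) (t : ℕ) (S : Subset (n G)) (x : Fin (n G)) →
    IsInducedStar G S x → Secluded G t S →
    IsVertexCoverF G x (N G S)
    × (IsMaximalSecludedStar G t S x → IsMinimalVertexCoverF G x (N G S))
mainTheorem14 G t S x star _ = N-cover , N-minimal-cover
  where open InducedStar G star
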